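{- Let $f:\mathbb{N}_0\to\mathbb{N}_0$ be a function with $f(n)=\omega(n^{3/2})$. For every $n\ge0$ let $S_n=[-f(n),f(n)]^2$ and $\underline{S}=(S_n)_{n\ge0}$. Then for every sequence of activated vertices $\underline{v}$, the burning density $\delta(\underline{S},\underline{v})$ exists and equals $0$.
   Context: $\mathbb{N}_0$ is the set of nonnegative integers. For an integer $a\ge0$, $[-a,a]^2$ denotes the graph on vertex set $[-a,a]^2\subset\mathbb{Z}^2$ in which two vertices are adjacent iff their $L_1$-distance is $1$. Burning process: let $\underline{G}=(G_0,G_1,\dots)$ be graphs with $G_{n-1}$ an induced subgraph of $G_n$ for all $n\ge1$. A sequence of activated vertices is $\underline{v}=(v_n)_{n\ge0}$ with $v_n\in V(G_n)\cup\{\bullet\}$ ($\bullet$ means no vertex is activated). Burning sets: $B_0=\{v_0\}$ (empty if $v_0=\bullet$), and $B_{n+1}=N_{G_{n+1}}[B_n]$ if $v_{n+1}=\bullet$, and $B_{n+1}=N_{G_{n+1}}[B_n]\cup\{v_{n+1}\}$ otherwise, where $N_G[X]$ is the closed neighbourhood of $X$ in $G$. The burning density is $\delta(\underline{G},\underline{v})=\lim_{n\to\infty}|B_n|/|V(G_n)|$ when the limit exists. -}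

module Defs where

open import Data.Nat as ℕ using (ℕ; zero; suc; _≤_; _≤ᵇ_)
open import Data.Integer as ℤ using (ℤ; +_; ∣_∣; _-_; _+_)
open import Data.Bool using (Bool; true; false; _∧_; _∨_)
open import Data.Maybe using (Maybe; just; nothing)
open import Data.Product using (Σ; _×_; _,_; proj₁)
open import Data.List using (List; []; _∷_; map; upTo; concatMap)
open import Relation.Nullary.Decidable using (⌊_⌋)
open import Relation.Binary.PropositionalEquality using (_≡_)

Point : Set
Point = ℤ × ℤ

InBox : ℕ → Point → Set
InBox a (x , y) = (∣ x ∣ ≤ a) × (∣ y ∣ ≤ a)

inBoxᵇ : ℕ → Point → Bool
inBoxᵇ a (x , y) = (∣ x ∣ ≤ᵇ a) ∧ (∣ y ∣ ≤ᵇ a)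

Vertex : ℕ → Set
Vertex a = Σ Point (InBox a)

_==ᵖ_ : Point → Point → Bool
(x , y) ==ᵖ (x' , y') = ⌊ x ℤ.≟ x' ⌋ ∧ ⌊ y ℤ.≟ y' ⌋

-- A sequence of activated vertices for S = (S_n), S_n = [-f n, f n]²:
-- v n = nothing encodes •, v n = just u with u ∈ V(S_n).
Activation : (ℕ → ℕ) → Set
Activation f = (n : ℕ) → Maybe (Vertex (f n))

activated : (f : ℕ → ℕ) → Activation f → ℕ → Point → Bool
activated f v n p with v n
... | nothing = false
... | just (q , _) = q ==ᵖ p

closedNbhd : (Point → Bool) → Point → Bool
closedNbhd P (x , y) =
  P (x , y) ∨ P (x + ℤ.+ 1 , y) ∨ P (x - ℤ.+ 1 , y)
            ∨ P (x , y + ℤ.+ 1) ∨ P (x , y - ℤ.+ 1)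

-- Burning sets B_n (as boolean predicates on ℤ²):
-- B_0 = {v_0};  B_{n+1} = N_{S_{n+1}}[B_n] ∪ {v_{n+1}}.
burning : (f : ℕ → ℕ) → Activation f → ℕ → Point → Bool
burning f v zero p = activated f v zero p
burning f v (suc n) p =
  (inBoxᵇ (f (suc n)) p ∧ closedNbhd (burning f v n) p) ∨ activated f v (suc n) p

range : ℕ → List ℤ
range a = map (λ k → (+ k) - (+ a)) (upTo (suc (2 ℕ.* a)))

boxPoints : ℕ → List Point
boxPoints a = concatMap (λ x → map (λ y → (x , y)) (range a)) (range a)

countᵇ : {A : Set} → (A → Bool) → List A → ℕ
countᵇ P [] = zero
countᵇ P (x ∷ xs) with P x
... | true = suc (countᵇ P xs)
... | false = countᵇ P xs

burnCount : (f : ℕ → ℕ) → Activation f → ℕ → ℕ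
burnCount f v n = countᵇ (burning f v n) (boxPoints (f n))

module Submission where

-- A point burning at time n was reached by fire spreading
-- for at most n steps from some vertex v_i activated at a time i ≤ n; each step
-- moves to an L1-neighbour, so the point lies in the Chebyshev ball of radius n
-- around v_i.  Such a ball meets any box [-a,a]² in at most (2n+1)² points, so
--     |B_n| ≤ (n+1)(2n+1)² ≤ 27 n³          (n ≥ 1),
-- independently of the box.  Since f(n)² eventually exceeds C n³ for every C,
-- the ratio |B_n| / (2 f(n) + 1)² eventually drops below 1/(k+1) for every k,
-- i.e. the burning density exists and equals 0.

open import Defs
open import Data.Nat using (ℕ; suc; _≤_; _<_; _*_; _+_; _^_)
open import Data.Product using (∃-syntax)

open import Data.Nat using (zero; _∸_; z≤n; s≤s; _≤ᵇ_)
open import Data.Nat.Properties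
  using ( ≤-refl; ≤-reflexive; ≤-total; ≤-trans; n≤1+n; m≤n⇒m≤1+n
        ; m≤n⇒m<n∨m≡n; +-comm; +-suc; +-∸-assoc; m≤n+m∸n; m≤n+o⇒m∸n≤o
        ; ∸-monoˡ-≤; +-mono-≤; +-monoʳ-≤; m≤m+n; *-mono-≤; *-monoʳ-≤
        ; *-identityˡ; *-assoc; *-distribʳ-+; +-identityʳ; m≤n*m; ^-monoˡ-≤
        ; ≤ᵇ⇒≤; ≤⇒≤ᵇ; module ≤-Reasoning )
open import Data.Nat.Tactic.RingSolver as ℕ-Solver using ()
open import Data.Integer as Z using (ℤ; +_; ∣_∣)
import Data.Integer.Properties as ZP
open import Data.Integer.Tactic.RingSolver as ℤ-Solver using ()
open import Data.Bool using (Bool; true; false; _∧_; _∨_; T)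
open import Data.Bool.Properties using (T-∧; T-∨)
open import Data.Unit using (tt)
open import Data.Empty using (⊥-elim)
open import Data.Maybe using (Maybe; just; nothing)
open import Data.Product using (_×_; _,_; proj₁; proj₂)
open import Data.Sum using (inj₁; inj₂)
open import Data.List using (List; []; _∷_; _++_; map; upTo; concatMap)
open import Data.List.Properties using (applyUpTo-∷ʳ)
open import Function using (_∘_; id)
open import Function.Bundles using (module Equivalence)
open import Relation.Nullary.Decidable using (⌊_⌋; toWitness)
open import Relation.Binary.PropositionalEquality
  using (_≡_; refl; sym; trans; cong; cong₂; subst; module ≡-Reasoning)

open Equivalence using (to; from)

-- Counting with a boolean predicate

module _ {A : Set} where

  count-++ : ∀ (P : A → Bool) xs ys → countᵇ P (xs ++ ys) ≡ countᵇ P xs + countᵇ P ys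
  count-++ P []       ys = refl
  count-++ P (x ∷ xs) ys with P x
  ... | true  = cong suc (count-++ P xs ys)
  ... | false = count-++ P xs ys

  count-map : ∀ {B : Set} (P : A → Bool) (g : B → A) xs →
              countᵇ P (map g xs) ≡ countᵇ (P ∘ g) xs
  count-map P g []       = refl
  count-map P g (x ∷ xs) with P (g x)
  ... | true  = cong suc (count-map P g xs)
  ... | false = count-map P g xs

  count-mono : ∀ (P Q : A → Bool) → (∀ x → T (P x) → T (Q x)) →
               ∀ xs → countᵇ P xs ≤ countᵇ Q xs
  count-mono P Q P⇒Q []       = z≤n
  count-mono P Q P⇒Q (x ∷ xs) with P x in p | Q x in q
  ... | true  | true  = s≤s (count-mono P Q P⇒Q xs)
  ... | true  | false = ⊥-elim (subst T q (P⇒Q x (subst T (sym p) tt)))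
  ... | false | true  = m≤n⇒m≤1+n (count-mono P Q P⇒Q xs)
  ... | false | false = count-mono P Q P⇒Q xs

  count-false : ∀ (xs : List A) → countᵇ (λ _ → false) xs ≡ 0
  count-false []       = refl
  count-false (x ∷ xs) = count-false xs

  count-∨ : ∀ (P Q : A → Bool) xs → countᵇ (λ x → P x ∨ Q x) xs ≤ countᵇ P xs + countᵇ Q xs
  count-∨ P Q [] = z≤n
  count-∨ P Q (x ∷ xs) with P x | Q x
  ... | true  | true  = s≤s (≤-trans (count-∨ P Q xs) (+-monoʳ-≤ (countᵇ P xs) (n≤1+n _)))
  ... | true  | false = s≤s (count-∨ P Q xs)
  ... | false | true  = ≤-trans (s≤s (count-∨ P Q xs)) (≤-reflexive (sym (+-suc _ _)))
  ... | false | false = count-∨ P Q xs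

  ⋃≤ : (ℕ → A → Bool) → ℕ → A → Bool
  ⋃≤ P zero    x = P zero x
  ⋃≤ P (suc m) x = P (suc m) x ∨ ⋃≤ P m x

  ⋃≤-intro : ∀ (P : ℕ → A → Bool) {i} m x → i ≤ m → T (P i x) → T (⋃≤ P m x)
  ⋃≤-intro P zero    x z≤n  Pix = Pix
  ⋃≤-intro P (suc m) x i≤1+m Pix with m≤n⇒m<n∨m≡n i≤1+m
  ... | inj₂ refl      = from T-∨ (inj₁ Pix)
  ... | inj₁ (s≤s i≤m) = from T-∨ (inj₂ (⋃≤-intro P m x i≤m Pix))

  count-⋃≤ : ∀ (P : ℕ → A → Bool) B xs → (∀ i → countᵇ (P i) xs ≤ B) →
             ∀ m → countᵇ (⋃≤ P m) xs ≤ suc m * B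
  count-⋃≤ P B xs bound zero    = ≤-trans (bound zero) (≤-reflexive (sym (*-identityˡ B)))
  count-⋃≤ P B xs bound (suc m) =
    ≤-trans (count-∨ (P (suc m)) (⋃≤ P m) xs) (+-mono-≤ (bound (suc m)) (count-⋃≤ P B xs bound m))

count-row : ∀ {X Y : Set} (A : X → Bool) (B : Y → Bool) x ys →
  countᵇ (λ y → A x ∧ B y) ys ≡ countᵇ A (x ∷ []) * countᵇ B ys
count-row A B x ys with A x
... | true  = sym (+-identityʳ (countᵇ B ys))
... | false = count-false ys

count-product : ∀ {X Y : Set} (A : X → Bool) (B : Y → Bool) xs ys →
  countᵇ (λ p → A (proj₁ p) ∧ B (proj₂ p)) (concatMap (λ x → map (λ y → (x , y)) ys) xs)
    ≡ countᵇ A xs * countᵇ B ys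
count-product     A B []       ys = refl
count-product {X} {Y} A B (x ∷ xs) ys = begin
  countᵇ A×B (map (x ,_) ys ++ grid xs)        ≡⟨ count-++ A×B (map (x ,_) ys) (grid xs) ⟩
  countᵇ A×B (map (x ,_) ys) + countᵇ A×B (grid xs)
    ≡⟨ cong₂ _+_ (trans (count-map A×B (x ,_) ys) (count-row A B x ys)) (count-product A B xs ys) ⟩
  countᵇ A (x ∷ []) * countᵇ B ys + countᵇ A xs * countᵇ B ys
    ≡⟨ *-distribʳ-+ (countᵇ B ys) (countᵇ A (x ∷ [])) (countᵇ A xs) ⟨
  (countᵇ A (x ∷ []) + countᵇ A xs) * countᵇ B ys ≡⟨ cong (_* countᵇ B ys) (count-++ A (x ∷ []) xs) ⟨
  countᵇ A (x ∷ xs) * countᵇ B ys               ∎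
  where
  open ≡-Reasoning
  A×B : X × Y → Bool
  A×B p = A (proj₁ p) ∧ B (proj₂ p)
  grid : List X → List (X × Y)
  grid = concatMap (λ x → map (λ y → (x , y)) ys)

count-upTo-suc : ∀ (Q : ℕ → Bool) L → countᵇ Q (upTo (suc L)) ≡ countᵇ Q (L ∷ []) + countᵇ Q (upTo L)
count-upTo-suc Q L = begin
  countᵇ Q (upTo (suc L))                ≡⟨ cong (countᵇ Q) (applyUpTo-∷ʳ id L) ⟨
  countᵇ Q (upTo L ++ L ∷ [])            ≡⟨ count-++ Q (upTo L) (L ∷ []) ⟩
  countᵇ Q (upTo L) + countᵇ Q (L ∷ [])  ≡⟨ +-comm (countᵇ Q (upTo L)) _ ⟩
  countᵇ Q (L ∷ []) + countᵇ Q (upTo L)  ∎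
  where open ≡-Reasoning

count-above : ∀ (Q : ℕ → Bool) lo → (∀ k → T (Q k) → lo ≤ k) →
              ∀ L → countᵇ Q (upTo L) ≤ L ∸ lo
count-above Q lo above zero = z≤n
count-above Q lo above (suc L) rewrite count-upTo-suc Q L with Q L in QL
... | true  = ≤-trans (s≤s (count-above Q lo above L))
                      (≤-reflexive (sym (+-∸-assoc 1 (above L (subst T (sym QL) tt)))))
... | false = ≤-trans (count-above Q lo above L) (∸-monoˡ-≤ lo (n≤1+n L))

window-count : ∀ (Q : ℕ → Bool) w → (∀ k k' → T (Q k) → T (Q k') → k' ≤ k + w) →
               ∀ L → countᵇ Q (upTo L) ≤ suc w
window-count Q w diam zero = z≤n
window-count Q w diam (suc L) rewrite count-upTo-suc Q L with Q L in QL
... | true  = s≤s (≤-trans (count-above Q (L ∸ w) above L) (m≤n+o⇒m∸n≤o L (L ∸ w) L≤L∸w+w))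
  where
  above : ∀ k → T (Q k) → L ∸ w ≤ k
  above k Qk = m≤n+o⇒m∸n≤o L w (subst (L ≤_) (+-comm k w) (diam k L Qk (subst T (sym QL) tt)))
  L≤L∸w+w : L ≤ (L ∸ w) + w
  L≤L∸w+w = subst (L ≤_) (+-comm w (L ∸ w)) (m≤n+m∸n L w)
... | false = window-count Q w diam L

-- Distances in ℤ and Chebyshev balls in ℤ²

dist : ℤ → ℤ → ℕ
dist x y = ∣ x Z.- y ∣

dist-self : ∀ x → dist x x ≡ 0
dist-self x = cong ∣_∣ (ZP.+-inverseʳ x)

dist-sym : ∀ x y → dist x y ≡ dist y x
dist-sym = ZP.∣i-j∣≡∣j-i∣

dist-triangle : ∀ x y z → dist x z ≤ dist x y + dist y z
dist-triangle x y z = begin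
  ∣ x Z.- z ∣                     ≡⟨ cong ∣_∣ (split x y z) ⟩
  ∣ (x Z.- y) Z.+ (y Z.- z) ∣     ≤⟨ ZP.∣i+j∣≤∣i∣+∣j∣ (x Z.- y) (y Z.- z) ⟩
  ∣ x Z.- y ∣ + ∣ y Z.- z ∣       ∎
  where
  open ≤-Reasoning
  split : ∀ x y z → x Z.- z ≡ (x Z.- y) Z.+ (y Z.- z)
  split = ℤ-Solver.solve-∀

dist-shift : ∀ x d → dist x (x Z.+ d) ≡ ∣ d ∣
dist-shift x d = trans (cong ∣_∣ (minus-shift x d)) (ZP.∣-i∣≡∣i∣ d)
  where
  minus-shift : ∀ x d → x Z.- (x Z.+ d) ≡ Z.- d
  minus-shift = ℤ-Solver.solve-∀

index-gap : ∀ k k' → k' ≤ k + dist (+ k') (+ k)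
index-gap k k' with ≤-total k k'
... | inj₁ k≤k' rewrite ZP.[+m]-[+n]≡m⊖n k' k | ZP.⊖-≥ k≤k' = m≤n+m∸n k' k
... | inj₂ k'≤k = ≤-trans k'≤k (m≤m+n k _)

coord-count : ∀ a c R → countᵇ (λ x → dist x c ≤ᵇ R) (range a) ≤ suc (R + R)
coord-count a c R = begin
  countᵇ P (range a)                  ≡⟨ count-map P g (upTo (suc (2 * a))) ⟩
  countᵇ (P ∘ g) (upTo (suc (2 * a))) ≤⟨ window-count (P ∘ g) (R + R) diameter _ ⟩
  suc (R + R)                         ∎
  where
  open ≤-Reasoning
  P : ℤ → Bool
  P x = dist x c ≤ᵇ R
  g : ℕ → ℤ
  g k = + k Z.- + a
  same-offset : ∀ x y a → (x Z.- a) Z.- (y Z.- a) ≡ x Z.- y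
  same-offset = ℤ-Solver.solve-∀
  diameter : ∀ k k' → T (P (g k)) → T (P (g k')) → k' ≤ k + (R + R)
  diameter k k' Pk Pk' = ≤-trans (index-gap k k') (+-monoʳ-≤ k (begin
    dist (+ k') (+ k)             ≡⟨ cong ∣_∣ (same-offset (+ k') (+ k) (+ a)) ⟨
    dist (g k') (g k)             ≤⟨ dist-triangle (g k') c (g k) ⟩
    dist (g k') c + dist c (g k)  ≡⟨ cong (λ d → dist (g k') c + d) (dist-sym c (g k)) ⟩
    dist (g k') c + dist (g k) c  ≤⟨ +-mono-≤ (≤ᵇ⇒≤ (dist (g k') c) R Pk') (≤ᵇ⇒≤ (dist (g k) c) R Pk) ⟩
    R + R                         ∎))

Near : ℕ → Point → Point → Set
Near R q p = (dist (proj₁ p) (proj₁ q) ≤ R) × (dist (proj₂ p) (proj₂ q) ≤ R)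

nearᵇ : ℕ → Point → Point → Bool
nearᵇ R q p = (dist (proj₁ p) (proj₁ q) ≤ᵇ R) ∧ (dist (proj₂ p) (proj₂ q) ≤ᵇ R)

Near⇒nearᵇ : ∀ R q p → Near R q p → T (nearᵇ R q p)
Near⇒nearᵇ R q p (near₁ , near₂) = from T-∧ (≤⇒≤ᵇ near₁ , ≤⇒≤ᵇ near₂)

near-refl : ∀ R p → Near R p p
near-refl R (x , y) = subst (_≤ R) (sym (dist-self x)) z≤n , subst (_≤ R) (sym (dist-self y)) z≤n

near-trans : ∀ {R S} q r p → Near R q r → Near S r p → Near (S + R) q p
near-trans q r p (qr₁ , qr₂) (rp₁ , rp₂) =
  ≤-trans (dist-triangle (proj₁ p) (proj₁ r) (proj₁ q)) (+-mono-≤ rp₁ qr₁) ,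
  ≤-trans (dist-triangle (proj₂ p) (proj₂ r) (proj₂ q)) (+-mono-≤ rp₂ qr₂)

ball-count : ∀ a R q → countᵇ (nearᵇ R q) (boxPoints a) ≤ suc (R + R) * suc (R + R)
ball-count a R (x , y) = ≤-trans
  (≤-reflexive (count-product (λ x' → dist x' x ≤ᵇ R) (λ y' → dist y' y ≤ᵇ R) (range a) (range a)))
  (*-mono-≤ (coord-count a x R) (coord-count a y R))

around : ∀ {a} → ℕ → Maybe (Vertex a) → Point → Bool
around R nothing  p = false
around R (just u) p = nearᵇ R (proj₁ u) p

around-count : ∀ {a} b R (m : Maybe (Vertex a)) →
               countᵇ (around R m) (boxPoints b) ≤ suc (R + R) * suc (R + R)
around-count b R nothing  = ≤-trans (≤-reflexive (count-false (boxPoints b))) z≤n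
around-count b R (just u) = ball-count b R (proj₁ u)

-- Local geometry of the burning process

==ᵖ-sound : ∀ p q → T (p ==ᵖ q) → p ≡ q
==ᵖ-sound (x , y) (x' , y') same with to (T-∧ {⌊ x Z.≟ x' ⌋}) same
... | same₁ , same₂ = cong₂ _,_ (toWitness {a? = x Z.≟ x'} same₁) (toWitness {a? = y Z.≟ y'} same₂)

near-step-x : ∀ x y d → ∣ d ∣ ≤ 1 → Near 1 (x Z.+ d , y) (x , y)
near-step-x x y d d≤1 = subst (_≤ 1) (sym (dist-shift x d)) d≤1 , subst (_≤ 1) (sym (dist-self y)) z≤n

near-step-y : ∀ x y d → ∣ d ∣ ≤ 1 → Near 1 (x , y Z.+ d) (x , y)
near-step-y x y d d≤1 = subst (_≤ 1) (sym (dist-self x)) z≤n , subst (_≤ 1) (sym (dist-shift y d)) d≤1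

closedNbhd-witness : ∀ P p → T (closedNbhd P p) → ∃[ p' ] T (P p') × Near 1 p' p
closedNbhd-witness P (x , y) inN with to T-∨ inN
... | inj₁ here = (x , y) , here , near-refl 1 (x , y)
... | inj₂ inN with to T-∨ inN
... | inj₁ right = (x Z.+ + 1 , y) , right , near-step-x x y (+ 1) ≤-refl
... | inj₂ inN with to T-∨ inN
... | inj₁ left = (x Z.- + 1 , y) , left , near-step-x x y (Z.- + 1) ≤-refl
... | inj₂ inN with to T-∨ inN
... | inj₁ up   = (x , y Z.+ + 1) , up , near-step-y x y (+ 1) ≤-refl
... | inj₂ down = (x , y Z.- + 1) , down , near-step-y x y (Z.- + 1) ≤-refl

module Spreading (f : ℕ → ℕ) (v : Activation f) where

  activated-sound : ∀ n p → T (activated f v n p) → ∃[ u ] (v n ≡ just u) × (proj₁ u ≡ p)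
  activated-sound n p act with v n
  ... | just (q , q∈S) = (q , q∈S) , refl , ==ᵖ-sound q p act
  ... | nothing        = ⊥-elim act

  Reach : ℕ → Point → Set
  Reach n p = ∃[ i ] (i ≤ n) × ∃[ u ] (v i ≡ just u) × Near n (proj₁ u) p

  activated-reach : ∀ n p → T (activated f v n p) → Reach n p
  activated-reach n p act with activated-sound n p act
  ... | u , vn≡u , refl = n , ≤-refl , u , vn≡u , near-refl n (proj₁ u)

  reach-step : ∀ n p' p → Reach n p' → Near 1 p' p → Reach (suc n) p
  reach-step n p' p (i , i≤n , u , vi≡u , near) step =
    i , m≤n⇒m≤1+n i≤n , u , vi≡u , near-trans (proj₁ u) p' p near step

  burning-reach : ∀ n p → T (burning f v n p) → Reach n p
  burning-reach zero    p burnt = activated-reach zero p burnt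
  burning-reach (suc n) p burnt with to T-∨ burnt
  ... | inj₂ act    = activated-reach (suc n) p act
  ... | inj₁ spread with closedNbhd-witness (burning f v n) p (proj₂ (to T-∧ spread))
  ... | p' , burnt' , step = reach-step n p' p (burning-reach n p' burnt') step

  burning⊆balls : ∀ n p → T (burning f v n p) → T (⋃≤ (λ i → around n (v i)) n p)
  burning⊆balls n p burnt with burning-reach n p burnt
  ... | i , i≤n , u , vi≡u , near =
    ⋃≤-intro (λ i → around n (v i)) n p i≤n
      (subst (λ m → T (around n m p)) (sym vi≡u) (Near⇒nearᵇ n (proj₁ u) p near))

  burnCount-bound : ∀ n → burnCount f v n ≤ suc n * (suc (n + n) * suc (n + n))
  burnCount-bound n = ≤-trans
    (count-mono _ _ (burning⊆balls n) (boxPoints (f n)))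
    (count-⋃≤ (λ i → around n (v i)) (suc (n + n) * suc (n + n)) (boxPoints (f n)) (λ i → around-count (f n) n (v i)) n)

2n+1≤3n : ∀ n → 1 ≤ n → suc (n + n) ≤ 3 * n
2n+1≤3n n 1≤n = begin
  suc (n + n)  ≡⟨ +-comm 1 (n + n) ⟩
  n + n + 1    ≤⟨ +-monoʳ-≤ (n + n) 1≤n ⟩
  n + n + n    ≡⟨ three-times n ⟩
  3 * n        ∎
  where
  open ≤-Reasoning
  three-times : ∀ n → n + n + n ≡ 3 * n
  three-times = ℕ-Solver.solve-∀

cubic-bound : ∀ n → 1 ≤ n → suc n * (suc (n + n) * suc (n + n)) ≤ 27 * n ^ 3
cubic-bound n 1≤n = begin
  suc n * (suc (n + n) * suc (n + n))  ≤⟨ *-mono-≤ n+1≤3n (*-mono-≤ 2n+1≤3n′ 2n+1≤3n′) ⟩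
  3 * n * (3 * n * (3 * n))            ≡⟨ cube n ⟩
  27 * n ^ 3                           ∎
  where
  open ≤-Reasoning
  2n+1≤3n′ : suc (n + n) ≤ 3 * n
  2n+1≤3n′ = 2n+1≤3n n 1≤n
  n+1≤3n : suc n ≤ 3 * n
  n+1≤3n = ≤-trans (s≤s (m≤m+n n n)) 2n+1≤3n′
  -- n ^ 3 unfolds definitionally to n * (n * (n * 1))
  cube : ∀ n → 3 * n * (3 * n * (3 * n)) ≡ 27 * (n * (n * (n * 1)))
  cube = ℕ-Solver.solve-∀

corollary4 : (f : ℕ → ℕ)
    → (∀ m n → m ≤ n → f m ≤ f n)
    → (∀ C → ∃[ N ] (∀ n → N ≤ n → C * n ^ 3 < f n ^ 2))
    → (v : Activation f)
    → ∀ k → ∃[ N ] (∀ n → N ≤ n → suc k * burnCount f v n < (2 * f n + 1) ^ 2)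
corollary4 f _ superCubic v k with superCubic (suc k * 27)
... | N , beyondN = suc N , λ n N<n → begin-strict
  suc k * burnCount f v n  ≤⟨ *-monoʳ-≤ (suc k) (Spreading.burnCount-bound f v n) ⟩
  suc k * (suc n * (suc (n + n) * suc (n + n)))
                           ≤⟨ *-monoʳ-≤ (suc k) (cubic-bound n (≤-trans (s≤s z≤n) N<n)) ⟩
  suc k * (27 * n ^ 3)     ≡⟨ *-assoc (suc k) 27 (n ^ 3) ⟨
  suc k * 27 * n ^ 3       <⟨ beyondN n (≤-trans (n≤1+n N) N<n) ⟩
  f n ^ 2                  ≤⟨ ^-monoˡ-≤ 2 (≤-trans (m≤n*m (f n) 2) (m≤m+n (2 * f n) 1)) ⟩
  (2 * f n + 1) ^ 2        ∎
  where open ≤-Reasoning
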